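{- Let $k\geq 2$ be an integer, let $H$ be a graph and $\mathcal{C}_H$ a collection of pairwise disjoint non-empty subsets of $V(H)$ such that for each $D\in\mathcal{C}_H$ we have $\overline{e}_H(D)\leq (k-1)|D|+1$ and $\deg_H(v)\geq k$ for all $v\in D$. Let $w\in V_{\leq k-1}(H)$ with $\operatorname{sh}_H(w)\neq V(H)$. Then $$V_{\leq k-1}(H-\operatorname{sh}_H(w))\subseteq V_{\leq k-1}(H)\setminus \{w\}.$$
   Context: Graphs are finite and simple. $V_{\leq k-1}(G)$ is the set of vertices of $G$ of degree at most $k-1$. For $X\subseteq V(H)$, $\overline{e}_H(X)$ is the number of edges of $H$ incident with at least one vertex of $X$, and $H-X$ is the graph obtained by deleting $X$. A vertex $v$ is adjacent to a set $X$ if it is adjacent to some vertex of $X$. For $w\in V_{\leq k-1}(H)$, the shadow $\operatorname{sh}_H(w)$ (with respect to $\mathcal{C}_H$) is the unique minimal (under inclusion) set $Y\subseteq V(H)$ such that: (I) $w\in Y$; (II) for each $D\in\mathcal{C}_H$, either $D\subseteq Y$ or $D\cap Y=\emptyset$; (III) if $v\in V(H)\setminus Y$ is adjacent to a vertex in $Y$, then $\deg_{H-Y}(v)\geq k$; (IV) if $D\in\mathcal{C}_H$ is adjacent to a vertex in $Y$, then $D\subseteq Y$. -}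

module Defs where

open import Data.Nat using (ℕ; _+_; _*_; _∸_; _≤_; _<ᵇ_)
open import Data.Bool using (Bool; true; false; if_then_else_; _∧_; _∨_; not)
open import Data.Fin using (Fin; toℕ)
open import Data.Fin.Subset using (Subset; _∈_; _∉_; _⊆_; ∣_∣; Nonempty)
open import Data.Vec using (lookup)
open import Data.List using (List; map; allFin; length; lookup)
open import Data.Nat.ListAction using (sum)
open import Data.Product using (Σ; _×_; ∃; _,_)
open import Relation.Binary.PropositionalEquality using (_≡_; _≢_)
open import Relation.Nullary using (¬_)

record Graph (n : ℕ) : Set where
  field
    adj   : Fin n → Fin n → Bool
    sym   : ∀ u v → adj u v ≡ adj v u
    irrefl : ∀ v → adj v v ≡ false
open Graph public

count : {n : ℕ} → (Fin n → Bool) → ℕ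
count {n} f = sum (map (λ u → if f u then 1 else 0) (allFin n))

mem : {n : ℕ} → Fin n → Subset n → Bool
mem u X = Data.Vec.lookup X u

deg : {n : ℕ} → Graph n → Fin n → ℕ
deg G v = count (λ u → adj G u v)

-- deg_{H-Y}(v)  (meaningful for v ∉ Y): neighbours of v outside Y
degDel : {n : ℕ} → Graph n → Subset n → Fin n → ℕ
degDel G Y v = count (λ u → adj G u v ∧ not (mem u Y))

-- ē_H(X): number of edges {u,v} (counted once, via toℕ u < toℕ v)
-- incident with at least one vertex of X
ebar : {n : ℕ} → Graph n → Subset n → ℕ
ebar {n} G X = sum (map (λ u → count (λ v →
  (toℕ u <ᵇ toℕ v) ∧ adj G u v ∧ (mem u X ∨ mem v X))) (allFin n))

AdjToSet : {n : ℕ} → Graph n → Fin n → Subset n → Set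
AdjToSet G v Y = ∃ λ u → u ∈ Y × adj G v u ≡ true

SetAdjToSet : {n : ℕ} → Graph n → Subset n → Subset n → Set
SetAdjToSet G D Y = ∃ λ v → v ∈ D × AdjToSet G v Y

Disjoint : {n : ℕ} → Subset n → Subset n → Set
Disjoint D E = ∀ x → x ∈ D → x ∈ E → ⊥'
  where open import Data.Empty renaming (⊥ to ⊥')

-- Conditions (I)-(IV) for Y with respect to w and the collection C
ShadowConds : {n : ℕ} → ℕ → Graph n → List (Subset n) → Fin n → Subset n → Set
ShadowConds {n} k G C w Y =
    (w ∈ Y)
  × (∀ (i : Fin (length C)) → (Data.List.lookup C i ⊆ Y) Data.Sum.⊎ Disjoint (Data.List.lookup C i) Y)
  × (∀ v → v ∉ Y → AdjToSet G v Y → k ≤ degDel G Y v)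
  × (∀ (i : Fin (length C)) → SetAdjToSet G (Data.List.lookup C i) Y → Data.List.lookup C i ⊆ Y)
  where import Data.Sum

-- Y is the shadow sh_H(w): the unique minimal set satisfying (I)-(IV).
-- (In a finite family, "unique minimal" is equivalent to "least".)
IsShadow : {n : ℕ} → ℕ → Graph n → List (Subset n) → Fin n → Subset n → Set
IsShadow k G C w Y =
  ShadowConds k G C w Y × (∀ Z → ShadowConds k G C w Z → Y ⊆ Z)

module Submission where

-- Let Y = sh_H(w) and let v ∉ Y have degree at most k-1 in
-- H - Y.  Only conditions (I) and (III) of the shadow are needed:
--   * v ≠ w, because w ∈ Y by (I) while v ∉ Y;
--   * v is not adjacent to Y: otherwise (III) would give deg_{H-Y}(v) ≥ k.
--     Having no neighbour in Y, v keeps all its neighbours when Y is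
--     deleted, so deg_H(v) = deg_{H-Y}(v) ≤ k-1.
-- The file first shows that counting respects pointwise equality of
-- predicates, then that deleting a set not adjacent to v preserves the
-- degree of v, then that adjacency to a set is decidable, and combines
-- these into the general fact that a vertex outside a set satisfying (III)
-- with small degree in H - Y has the same degree in H.

open import Defs
open import Data.Nat using (ℕ; _+_; _*_; _∸_; _≤_; suc; s≤s)
open import Data.Nat.Properties using (≤-trans; 1+n≰n)
open import Data.Nat.ListAction using (sum)
open import Data.Fin using (Fin)
open import Data.Fin.Subset using (Subset; _∈_; _∉_; ⊤; ∣_∣; Nonempty)
open import Data.Fin.Subset.Properties using (_∈?_)
open import Data.Fin.Properties using (any?)
open import Data.List using (List; length; lookup; map; allFin)
open import Data.List.Properties using (map-cong)
open import Data.Product using (_×_; _,_)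
open import Data.Bool using (Bool; true; false; _∧_; not; if_then_else_)
open import Data.Bool.Properties using (∧-identityʳ) renaming (_≟_ to _≟ᵇ_)
open import Data.Vec.Properties using (lookup⇒[]=)
open import Data.Empty using (⊥-elim)
open import Relation.Nullary using (Dec; yes; no; ¬_)
open import Relation.Nullary.Decidable using (_×-dec_)
open import Relation.Binary.PropositionalEquality
  using (_≡_; _≢_; refl; cong; trans; subst)
  renaming (sym to ≡-sym)

count-cong : ∀ {n} {f g : Fin n → Bool} → (∀ u → f u ≡ g u) → count f ≡ count g
count-cong {n} f≗g =
  cong sum (map-cong (λ u → cong (λ b → if b then 1 else 0) (f≗g u)) (allFin n))

degDel-nonadjacent : ∀ {n} (H : Graph n) (Y : Subset n) (v : Fin n)
  → ¬ AdjToSet H v Y → degDel H Y v ≡ deg H v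
degDel-nonadjacent H Y v v≁Y = count-cong same-neighbour
  where
  -- every neighbour u of v lies outside Y, so the extra test is redundant
  same-neighbour : ∀ u → (adj H u v ∧ not (mem u Y)) ≡ adj H u v
  same-neighbour u with mem u Y in u∈ᵇY
  ... | false = ∧-identityʳ (adj H u v)
  ... | true with adj H u v in uv
  ...   | false = refl
  ...   | true  = ⊥-elim (v≁Y (u , lookup⇒[]= u Y u∈ᵇY , trans (Graph.sym H v u) uv))

adjToSet? : ∀ {n} (H : Graph n) (v : Fin n) (Y : Subset n) → Dec (AdjToSet H v Y)
adjToSet? H v Y = any? (λ u → (u ∈? Y) ×-dec (adj H v u ≟ᵇ true))

deg-outside≡degDel : ∀ {n} (t : ℕ) (H : Graph n) (Y : Subset n)
  → (∀ u → u ∉ Y → AdjToSet H u Y → t ≤ degDel H Y u)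
  → ∀ v → v ∉ Y → ¬ (t ≤ degDel H Y v) → deg H v ≡ degDel H Y v
deg-outside≡degDel t H Y cond-III v v∉Y small with adjToSet? H v Y
... | yes v∼Y = ⊥-elim (small (cond-III v v∉Y v∼Y))
... | no  v≁Y = ≡-sym (degDel-nonadjacent H Y v v≁Y)

claim4p13 : (k : ℕ) → 2 ≤ k → (n : ℕ) → (H : Graph n) → (C : List (Subset n))
    → (∀ (i j : Fin (length C)) → i ≢ j → Disjoint (lookup C i) (lookup C j))
    → (∀ (i : Fin (length C)) → Nonempty (lookup C i))
    → (∀ (i : Fin (length C)) → ebar H (lookup C i) ≤ (k ∸ 1) * ∣ lookup C i ∣ + 1)
    → (∀ (i : Fin (length C)) → ∀ v → v ∈ lookup C i → k ≤ deg H v)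
    → (w : Fin n) → deg H w ≤ k ∸ 1
    → (Y : Subset n) → IsShadow k H C w Y → Y ≢ ⊤
    → ∀ v → v ∉ Y → degDel H Y v ≤ k ∸ 1
    → (deg H v ≤ k ∸ 1) × (v ≢ w)
claim4p13 (suc k) (s≤s _) n H C _ _ _ _ w _ Y ((w∈Y , _ , cond-III , _) , _) _ v v∉Y degDel≤k =
  low-degree , v≢w
  where
  below-threshold : ¬ (suc k ≤ degDel H Y v)
  below-threshold k<degDel = 1+n≰n (≤-trans k<degDel degDel≤k)

  low-degree : deg H v ≤ k
  low-degree = subst (_≤ k) deg≡degDel degDel≤k
    where
    deg≡degDel : degDel H Y v ≡ deg H v
    deg≡degDel = ≡-sym (deg-outside≡degDel (suc k) H Y cond-III v v∉Y below-threshold)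

  v≢w : v ≢ w
  v≢w refl = v∉Y w∈Y
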